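{- Let $G$ be a finite simple graph and let $k$ be an integer with $k>\chi(G)$. Then $G$ can be determined up to isomorphism from the $k$-recolouring graph $\mathcal{C}_k(G)$ alone, even without knowing the value of $k$. Precisely: if $H$ is any finite simple graph and $k'$ is an integer with $k'>\chi(H)$ and $\mathcal{C}_{k'}(H)\cong\mathcal{C}_k(G)$, then $H\cong G$.
   Context: All graphs are finite and simple. For a positive integer $k$, a (proper) $k$-colouring of $G$ is a map $V(G)\to[k]=\{1,\dots,k\}$ assigning different colours to adjacent vertices; $\chi(G)$ is the least $k$ for which a $k$-colouring exists. The $k$-recolouring graph $\mathcal{C}_k(G)$ is the graph whose vertices are the $k$-colourings of $G$, two colourings being adjacent if and only if they differ at exactly one vertex of $G$. -}

module Defs where

open import Data.Nat using (ℕ; _<_; _≤_)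
open import Data.Fin using (Fin)
open import Data.Bool using (Bool; true; false; T)
open import Data.Vec using (Vec; lookup)
open import Data.Product using (Σ; ∃; _×_)
open import Relation.Binary.PropositionalEquality using (_≡_; _≢_)
open import Function.Bundles using (_↔_; Inverse)
open import Data.Irrelevant using (Irrelevant)

record Graph : Set where
  field
    order  : ℕ
    adj    : Fin order → Fin order → Bool
    irrefl : ∀ i → adj i i ≡ false
    sym    : ∀ i j → adj i j ≡ adj j i

open Graph public

_≅_ : Graph → Graph → Set
G ≅ H = Σ (Fin (order G) ↔ Fin (order H)) λ f →
  ∀ i j → adj H (Inverse.to f i) (Inverse.to f j) ≡ adj G i j

Map : Graph → ℕ → Set
Map G k = Vec (Fin k) (order G)

IsProper : (G : Graph) {k : ℕ} → Map G k → Set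
IsProper G c = ∀ i j → adj G i j ≡ true → lookup c i ≢ lookup c j

Colourable : Graph → ℕ → Set
Colourable G k = Σ (Map G k) (IsProper G)

IsChromaticNumber : Graph → ℕ → Set
IsChromaticNumber G m = Colourable G m × (∀ k → Colourable G k → m ≤ k)

ChiBelow : Graph → ℕ → Set
ChiBelow G k = ∃ λ m → IsChromaticNumber G m × m < k

record AbsGraph : Set₁ where
  field
    V : Set
    E : V → V → Set

record AbsIso (A B : AbsGraph) : Set where
  field
    bij     : AbsGraph.V A ↔ AbsGraph.V B
    preserve : ∀ u v → AbsGraph.E A u v → AbsGraph.E B (Inverse.to bij u) (Inverse.to bij v)
    reflect  : ∀ u v → AbsGraph.E B (Inverse.to bij u) (Inverse.to bij v) → AbsGraph.E A u v

DifferAtExactlyOne : ∀ {n k} → Vec (Fin k) n → Vec (Fin k) n → Set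
DifferAtExactlyOne {n} c d =
  Σ (Fin n) λ i → (lookup c i ≢ lookup d i) × (∀ j → j ≢ i → lookup c j ≡ lookup d j)

-- The properness proof is wrapped in Irrelevant, so two colourings are
-- equal iff their colour vectors are equal (no funext needed).
Recolouring : Graph → ℕ → AbsGraph
Recolouring G k = record
  { V = Σ (Map G k) (λ c → Irrelevant (IsProper G c))
  ; E = λ c d → DifferAtExactlyOne (Σ.proj₁ c) (Σ.proj₁ d)
  }

module Submission where

-- Fix a proper k-colouring α of A that leaves some colour c unused (possible as k > χ(A)), and let
-- β u be α with u recoloured c. The isomorphism φ sends the edge α β u of the recolouring graph to
-- an edge of the other one, recolouring a single vertex "moved u" of B. For u ≠ v the colourings
-- β u, β v are neither equal nor adjacent, so moved is injective. If uv is an edge of A, α is the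
-- only common neighbour of β u and β v; but if moved u, moved v were non-adjacent, recolouring
-- both of them in φ α would give a second common neighbour of φ (β u) and φ (β v). So moved
-- preserves edges. Injective edge-preserving maps in both directions between finite graphs are
-- isomorphisms, because they cannot increase the number of edges.

open import Defs hiding (sym; irrefl)
open import Data.Nat using (ℕ; zero; suc; _+_; _≤_; _<_; z≤n)
open import Data.Nat.Properties
  using (+-0-commutativeMonoid; +-mono-≤; +-mono-<-≤; +-cancelˡ-≡; 1+n≰n; <⇒≢; <⇒≤; ≤-refl; ≤-antisym; m≤n⇒m<n∨m≡n;
         module ≤-Reasoning)
open import Data.Fin using (Fin; zero; suc; punchOut; inject≤; fromℕ<; toℕ)
open import Data.Fin.Properties
  using (_≟_; any?; punchOut-injective; injective⇒≤; cantor-schröder-bernstein; toℕ<n; toℕ-inject≤; toℕ-fromℕ<; inject≤-injective)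
open import Data.Bool using (Bool; true; false)
open import Data.Vec using (Vec; lookup; map; _[_]≔_)
open import Data.Vec.Properties using (lookup∘update; lookup∘update′; lookup-map)
open import Data.Vec.Relation.Binary.Pointwise.Extensional using (ext; Pointwise-≡⇒≡)
open import Data.Irrelevant using ([_])
open import Data.Empty using (⊥-elim; ⊥-elim-irr)
open import Data.Sum using (_⊎_; inj₁; inj₂)
open import Data.Product using (Σ; _×_; _,_; proj₁; proj₂)
open import Function using (_∘_; Injective; StrictlySurjective; _↔_; Inverse; mk⤖)
open import Function.Consequences.Propositional using (strictlySurjective⇒surjective)
open import Function.Properties.Bijection using (⤖⇒↔)
open import Function.Construct.Symmetry using (↔-sym)
open import Relation.Nullary using (¬_; yes; no; contradiction)
open import Relation.Binary.PropositionalEquality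
  using (_≡_; _≢_; refl; sym; trans; cong; subst; subst₂; module ≡-Reasoning)
open import Algebra.Properties.CommutativeMonoid.Sum +-0-commutativeMonoid
  using (sum; sum-syntax; sum-cong-≗; ∑-permute)

private
  variable
    m n k : ℕ

∑-mono-≤ : {f g : Fin n → ℕ} → (∀ i → f i ≤ g i) → sum f ≤ sum g
∑-mono-≤ {zero}  f≤g = z≤n
∑-mono-≤ {suc n} f≤g = +-mono-≤ (f≤g zero) (∑-mono-≤ (f≤g ∘ suc))

∑-mono-≤-equality : {f g : Fin n → ℕ} → (∀ i → f i ≤ g i) → sum f ≡ sum g → ∀ i → f i ≡ g i
∑-mono-≤-equality {suc n} {f} {g} f≤g ∑f≡∑g = pointwise
  where
  head≡ : f zero ≡ g zero
  head≡ with m≤n⇒m<n∨m≡n (f≤g zero)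
  ... | inj₁ f₀<g₀ = contradiction ∑f≡∑g (<⇒≢ (+-mono-<-≤ f₀<g₀ (∑-mono-≤ (f≤g ∘ suc))))
  ... | inj₂ f₀≡g₀ = f₀≡g₀

  tail≡ : sum (f ∘ suc) ≡ sum (g ∘ suc)
  tail≡ = +-cancelˡ-≡ (f zero) _ _ (trans ∑f≡∑g (cong (_+ sum (g ∘ suc)) (sym head≡)))

  pointwise : ∀ i → f i ≡ g i
  pointwise zero    = head≡
  pointwise (suc i) = ∑-mono-≤-equality (f≤g ∘ suc) tail≡ i

Rel𝔹 : ℕ → Set
Rel𝔹 n = Fin n → Fin n → Bool

Preserves : Rel𝔹 m → Rel𝔹 n → (Fin m → Fin n) → Set
Preserves R S h = ∀ i j → R i j ≡ true → S (h i) (h j) ≡ true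

record Monomorphism (R : Rel𝔹 m) (S : Rel𝔹 n) : Set where
  field
    to        : Fin m → Fin n
    injective : Injective _≡_ _≡_ to
    preserves : Preserves R S to

indicator : Bool → ℕ
indicator false = 0
indicator true  = 1

indicator-mono : ∀ {a b} → (a ≡ true → b ≡ true) → indicator a ≤ indicator b
indicator-mono {false} a⇒b = z≤n
indicator-mono {true}  a⇒b rewrite a⇒b refl = ≤-refl

indicator-injective : ∀ {a b} → indicator a ≡ indicator b → a ≡ b
indicator-injective {false} {false} _ = refl
indicator-injective {true}  {true}  _ = refl

size : Rel𝔹 n → ℕ
size {n} R = ∑[ i < n ] ∑[ j < n ] indicator (R i j)

injective⇒strictlySurjective : {h : Fin n → Fin n} → Injective _≡_ _≡_ h → StrictlySurjective _≡_ h
injective⇒strictlySurjective {zero}      _     ()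
injective⇒strictlySurjective {suc n} {h} h-inj y with any? (λ x → h x ≟ y)
... | yes hit  = hit
... | no  miss = contradiction (injective⇒≤ punchOut∘h-injective) 1+n≰n
  where
  y≢h : ∀ x → y ≢ h x
  y≢h x y≡hx = miss (x , sym y≡hx)

  punchOut∘h-injective : Injective _≡_ _≡_ (λ x → punchOut (y≢h x))
  punchOut∘h-injective = h-inj ∘ punchOut-injective (y≢h _) (y≢h _)

injective⇒↔ : {h : Fin n → Fin n} → Injective _≡_ _≡_ h → Fin n ↔ Fin n
injective⇒↔ h-inj = ⤖⇒↔ (mk⤖ (h-inj , strictlySurjective⇒surjective (injective⇒strictlySurjective h-inj)))

size-permute : (R : Rel𝔹 n) (π : Fin n ↔ Fin n) →
               size R ≡ size (λ i j → R (Inverse.to π i) (Inverse.to π j))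
size-permute {n} R π = trans (∑-permute (λ i → ∑[ j < n ] indicator (R i j)) π)
  (sum-cong-≗ (λ i → ∑-permute (λ j → indicator (R (Inverse.to π i) j)) π))

monomorphism⇒size-≤ : {R S : Rel𝔹 n} → Monomorphism R S → size R ≤ size S
monomorphism⇒size-≤ {n} {R} {S} h = begin
  size R                                   ≤⟨ ∑-mono-≤ (λ i → ∑-mono-≤ (λ j → indicator-mono (preserves i j))) ⟩
  size (λ i j → S (to i) (to j))           ≡⟨ sym (size-permute S (injective⇒↔ injective)) ⟩
  size S                                   ∎
  where
  open Monomorphism h
  open ≤-Reasoning

monomorphisms⇒isomorphic : {R : Rel𝔹 m} {S : Rel𝔹 n} → Monomorphism R S → Monomorphism S R →
                           Σ (Fin m ↔ Fin n) λ π → ∀ i j → S (Inverse.to π i) (Inverse.to π j) ≡ R i j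
monomorphisms⇒isomorphic {R = R} {S} f g
  with refl ← cantor-schröder-bernstein (Monomorphism.injective f) (Monomorphism.injective g)
  = injective⇒↔ injective , λ i j → sym (indicator-injective (entries≡ i j))
  where
  open Monomorphism f

  entries≤ : ∀ i j → indicator (R i j) ≤ indicator (S (to i) (to j))
  entries≤ i j = indicator-mono (preserves i j)

  sizes≡ : size R ≡ size (λ i j → S (to i) (to j))
  sizes≡ = trans (≤-antisym (monomorphism⇒size-≤ f) (monomorphism⇒size-≤ g))
                 (size-permute S (injective⇒↔ injective))

  rows≡ : ∀ i → ∑[ j < _ ] indicator (R i j) ≡ ∑[ j < _ ] indicator (S (to i) (to j))
  rows≡ = ∑-mono-≤-equality (λ i → ∑-mono-≤ (entries≤ i)) sizes≡

  entries≡ : ∀ i j → indicator (R i j) ≡ indicator (S (to i) (to j))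
  entries≡ i = ∑-mono-≤-equality (entries≤ i) (rows≡ i)

AgreeOff : {A : Set} → Vec A n → Vec A n → Fin n → Set
AgreeOff x y i = ∀ j → j ≢ i → lookup x j ≡ lookup y j

agreeOff-trans : {A : Set} {x y z : Vec A n} {i : Fin n} → AgreeOff x y i → AgreeOff x z i → AgreeOff y z i
agreeOff-trans x≈y x≈z j j≢i = trans (sym (x≈y j j≢i)) (x≈z j j≢i)

agreeOff⇒≡⊎differ : {x y : Vec (Fin k) n} {i : Fin n} → AgreeOff x y i → x ≡ y ⊎ DifferAtExactlyOne x y
agreeOff⇒≡⊎differ {x = x} {y} {i} x≈y with lookup x i ≟ lookup y i
... | yes xᵢ≡yᵢ = inj₁ (Pointwise-≡⇒≡ (ext everywhere))
  where
  everywhere : ∀ j → lookup x j ≡ lookup y j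
  everywhere j with j ≟ i
  ... | yes refl = xᵢ≡yᵢ
  ... | no  j≢i  = x≈y j j≢i
... | no  xᵢ≢yᵢ = inj₂ (i , xᵢ≢yᵢ , x≈y)

differAtTwo⇒¬DifferAtExactlyOne : {x y : Vec (Fin k) n} {i j : Fin n} → i ≢ j →
  lookup x i ≢ lookup y i → lookup x j ≢ lookup y j → ¬ DifferAtExactlyOne x y
differAtTwo⇒¬DifferAtExactlyOne {i = i} {j} i≢j xᵢ≢yᵢ xⱼ≢yⱼ (l , _ , x≈y) with i ≟ l
... | yes refl = xⱼ≢yⱼ (x≈y j (i≢j ∘ sym))
... | no  i≢l  = xᵢ≢yᵢ (x≈y i i≢l)

[]≔-agreeOff : (α : Vec (Fin k) n) (u : Fin n) (c : Fin k) → AgreeOff (α [ u ]≔ c) α u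
[]≔-agreeOff α u c j j≢u = lookup∘update′ j≢u α c

updates-differ : {u v : Fin n} (α : Vec (Fin k) n) {c : Fin k} → u ≢ v → lookup α u ≢ c →
                 lookup (α [ u ]≔ c) u ≢ lookup (α [ v ]≔ c) u
updates-differ {u = u} {v} α {c} u≢v αᵤ≢c eq =
  αᵤ≢c (sym (trans (sym (lookup∘update u α c)) (trans eq ([]≔-agreeOff α v c u u≢v))))

common-neighbour-of-updates : {u v : Fin n} {α γ : Vec (Fin k) n} {c : Fin k} →
  u ≢ v → lookup α u ≢ c → lookup α v ≢ c →
  DifferAtExactlyOne γ (α [ u ]≔ c) → DifferAtExactlyOne γ (α [ v ]≔ c) →
  γ ≡ α ⊎ (lookup γ u ≡ c × lookup γ v ≡ c)
common-neighbour-of-updates {u = u} {v} {α} {γ} {c} u≢v αᵤ≢c αᵥ≢c (i , _ , γ≈βᵤ) (j , _ , γ≈βᵥ)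
  with i ≟ u | j ≟ v
... | yes refl | yes refl = inj₁ (Pointwise-≡⇒≡ (ext γ≈α))
  where
  γ≈α : ∀ x → lookup γ x ≡ lookup α x
  γ≈α x with x ≟ u
  ... | yes refl = trans (γ≈βᵥ u u≢v) ([]≔-agreeOff α v c u u≢v)
  ... | no  x≢u  = trans (γ≈βᵤ x x≢u) ([]≔-agreeOff α u c x x≢u)
... | yes refl | no j≢v = ⊥-elim (αᵥ≢c (begin
  lookup α v             ≡⟨ []≔-agreeOff α u c v (u≢v ∘ sym) ⟨
  lookup (α [ u ]≔ c) v  ≡⟨ γ≈βᵤ v (u≢v ∘ sym) ⟨
  lookup γ v             ≡⟨ γ≈βᵥ v (j≢v ∘ sym) ⟩
  lookup (α [ v ]≔ c) v  ≡⟨ lookup∘update v α c ⟩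
  c                      ∎))
  where open ≡-Reasoning
... | no i≢u | _ with j ≟ u
...   | yes refl = inj₂ (γᵤ≡c , trans (γ≈βᵥ v (u≢v ∘ sym)) (lookup∘update v α c))
  where
  γᵤ≡c : lookup γ u ≡ c
  γᵤ≡c = trans (γ≈βᵤ u (i≢u ∘ sym)) (lookup∘update u α c)
...   | no j≢u = ⊥-elim (αᵤ≢c (begin
  lookup α u             ≡⟨ []≔-agreeOff α v c u u≢v ⟨
  lookup (α [ v ]≔ c) u  ≡⟨ γ≈βᵥ u (j≢u ∘ sym) ⟨
  lookup γ u             ≡⟨ γ≈βᵤ u (i≢u ∘ sym) ⟩
  lookup (α [ u ]≔ c) u  ≡⟨ lookup∘update u α c ⟩
  c                      ∎))
  where open ≡-Reasoning

adj⇒≢ : (G : Graph) {i j : Fin (order G)} → adj G i j ≡ true → i ≢ j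
adj⇒≢ G {i} ij∈E refl with () ← trans (sym (Graph.irrefl G i)) ij∈E

properAwayFrom : (G : Graph) {δ d : Map G k} {x : Fin (order G)} → IsProper G d → AgreeOff δ d x →
                 ∀ i j → adj G i j ≡ true → i ≢ x → j ≢ x → lookup δ i ≢ lookup δ j
properAwayFrom G d-proper δ≈d i j ij∈E i≢x j≢x eq =
  d-proper i j ij∈E (trans (sym (δ≈d i i≢x)) (trans eq (δ≈d j j≢x)))

update-proper : (G : Graph) {α : Map G k} {c : Fin k} → IsProper G α → (∀ i → lookup α i ≢ c) →
                ∀ u → IsProper G (α [ u ]≔ c)
update-proper G {α} {c} α-proper c-unused u i j ij∈E with i ≟ u | j ≟ u
... | yes refl | yes refl = ⊥-elim (adj⇒≢ G ij∈E refl)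
... | yes refl | no  j≢u  = λ eq →
  c-unused j (trans (sym ([]≔-agreeOff α u c j j≢u)) (trans (sym eq) (lookup∘update u α c)))
... | no  i≢u  | yes refl = λ eq →
  c-unused i (trans (sym ([]≔-agreeOff α u c i i≢u)) (trans eq (lookup∘update u α c)))
... | no  i≢u  | no  j≢u  = properAwayFrom G {α [ u ]≔ c} {α} α-proper ([]≔-agreeOff α u c) i j ij∈E i≢u j≢u

neighbour≢non-neighbour : (G : Graph) {x y z : Fin (order G)} → adj G x y ≡ true → adj G x z ≡ false → y ≢ z
neighbour≢non-neighbour G xy∈E xz∉E refl = contradiction (trans (sym xy∈E) xz∉E) λ ()

patch-proper : (G : Graph) {δ d e : Map G k} {x y : Fin (order G)} → IsProper G d → IsProper G e →
               AgreeOff δ d x → AgreeOff δ e y → x ≢ y → adj G x y ≡ false → IsProper G δ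
patch-proper G {δ} {d} {e} {x} {y} d-proper e-proper δ≈d δ≈e x≢y xy∉E i j ij∈E with i ≟ x | j ≟ x
... | no  i≢x  | no  j≢x  = properAwayFrom G {δ} {d} d-proper δ≈d i j ij∈E i≢x j≢x
... | yes refl | yes refl = ⊥-elim (adj⇒≢ G ij∈E refl)
... | yes refl | no  _    = properAwayFrom G {δ} {e} e-proper δ≈e i j ij∈E x≢y
                              (neighbour≢non-neighbour G ij∈E xy∉E)
... | no  _    | yes refl = properAwayFrom G {δ} {e} e-proper δ≈e i j ij∈E
                              (neighbour≢non-neighbour G (trans (Graph.sym G x i) ij∈E) xy∉E) x≢y

record SpareColouring (G : Graph) (k : ℕ) : Set where
  field
    colours : Map G k
    proper  : IsProper G colours
    spare   : Fin k
    unused  : ∀ i → lookup colours i ≢ spare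

colourable⇒spareColouring : (G : Graph) → Colourable G m → m < k → SpareColouring G k
colourable⇒spareColouring {m} {k} G (α , α-proper) m<k = record
  { colours = map widen α
  ; proper  = λ i j ij∈E eq → α-proper i j ij∈E
                (widen-injective (trans (sym (lookup-map i widen α)) (trans eq (lookup-map j widen α))))
  ; spare   = fromℕ< m<k
  ; unused  = λ i eq → widen≢fromℕ< (lookup α i) (trans (sym (lookup-map i widen α)) eq)
  }
  where
  widen : Fin m → Fin k
  widen x = inject≤ x (<⇒≤ m<k)

  widen-injective : Injective _≡_ _≡_ widen
  widen-injective = inject≤-injective _ _ _ _

  widen≢fromℕ< : ∀ x → widen x ≢ fromℕ< m<k
  widen≢fromℕ< x eq = <⇒≢ (toℕ<n x) (begin
    toℕ x              ≡⟨ toℕ-inject≤ x (<⇒≤ m<k) ⟨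
    toℕ (widen x)      ≡⟨ cong toℕ eq ⟩
    toℕ (fromℕ< m<k)   ≡⟨ toℕ-fromℕ< m<k ⟩
    m                  ∎)
    where open ≡-Reasoning

Colouring : Graph → ℕ → Set
Colouring G k = AbsGraph.V (Recolouring G k)

colouring-proper : (G : Graph) (γ : Colouring G k) → IsProper G (proj₁ γ)
colouring-proper G (γ , [ γ-proper ]) i j ij∈E eq = ⊥-elim-irr (γ-proper i j ij∈E eq)

colouring-≡ : (G : Graph) {γ δ : Colouring G k} → proj₁ γ ≡ proj₁ δ → γ ≡ δ
colouring-≡ G refl = refl

AbsIso-sym : {A B : AbsGraph} → AbsIso A B → AbsIso B A
AbsIso-sym {A} {B} φ = record
  { bij      = ↔-sym bij
  ; preserve = λ u v e → reflect (from u) (from v)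
                 (subst₂ (AbsGraph.E B) (sym (strictlyInverseˡ u)) (sym (strictlyInverseˡ v)) e)
  ; reflect  = λ u v e → subst₂ (AbsGraph.E B) (strictlyInverseˡ u) (strictlyInverseˡ v)
                 (preserve (from u) (from v) e)
  }
  where
  open AbsIso φ
  open Inverse bij

module SpareColourEmbedding {A : Graph} {kA : ℕ} (s : SpareColouring A kA) (B : Graph) (kB : ℕ)
                            (φ : AbsIso (Recolouring A kA) (Recolouring B kB)) where
  open SpareColouring s renaming (colours to α)
  open AbsIso φ using (preserve; reflect)
  open Inverse (AbsIso.bij φ) using (to; from; strictlyInverseˡ; strictlyInverseʳ)

  _~ᴬ_ : Colouring A kA → Colouring A kA → Set
  _~ᴬ_ = AbsGraph.E (Recolouring A kA)

  _~ᴮ_ : Colouring B kB → Colouring B kB → Set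
  _~ᴮ_ = AbsGraph.E (Recolouring B kB)

  to-injective : Injective _≡_ _≡_ to
  to-injective {γ} {δ} eq = begin
    γ              ≡⟨ strictlyInverseʳ γ ⟨
    from (to γ)    ≡⟨ cong from eq ⟩
    from (to δ)    ≡⟨ strictlyInverseʳ δ ⟩
    δ              ∎
    where open ≡-Reasoning

  reflect-from : ∀ {δ γ} → δ ~ᴮ to γ → from δ ~ᴬ γ
  reflect-from {δ} {γ} δ~γ = reflect (from δ) γ (subst (_~ᴮ to γ) (sym (strictlyInverseˡ δ)) δ~γ)

  α̂ : Colouring A kA
  α̂ = α , [ proper ]

  β : Fin (order A) → Colouring A kA
  β u = α [ u ]≔ spare , [ update-proper A {α} proper unused u ]

  α~β : ∀ u → α̂ ~ᴬ β u
  α~β u = u , (λ eq → unused u (trans eq (lookup∘update u α spare))) , λ j j≢u → sym ([]≔-agreeOff α u spare j j≢u)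

  φα : Map B kB
  φα = proj₁ (to α̂)

  φβ : Fin (order A) → Map B kB
  φβ u = proj₁ (to (β u))

  moved : Fin (order A) → Fin (order B)
  moved u = proj₁ (preserve α̂ (β u) (α~β u))

  moved-differs : ∀ u → lookup φα (moved u) ≢ lookup (φβ u) (moved u)
  moved-differs u = proj₁ (proj₂ (preserve α̂ (β u) (α~β u)))

  φβ≈φα : ∀ u → AgreeOff φα (φβ u) (moved u)
  φβ≈φα u = proj₂ (proj₂ (preserve α̂ (β u) (α~β u)))

  β-injective : Injective _≡_ _≡_ β
  β-injective {u} {v} βu≡βv with u ≟ v
  ... | yes u≡v = u≡v
  ... | no  u≢v = contradiction (cong (λ γ → lookup (proj₁ γ) u) βu≡βv) (updates-differ α u≢v (unused u))

  β-≁ : ∀ {u v} → u ≢ v → ¬ (β u ~ᴬ β v)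
  β-≁ {u} {v} u≢v = differAtTwo⇒¬DifferAtExactlyOne {x = α [ u ]≔ spare} {α [ v ]≔ spare} u≢v
    (updates-differ α u≢v (unused u)) (updates-differ α (u≢v ∘ sym) (unused v) ∘ sym)

  φβ≈φβ : ∀ {u v} → moved u ≡ moved v → AgreeOff (φβ u) (φβ v) (moved u)
  φβ≈φβ {u} {v} mu≡mv =
    agreeOff-trans {x = φα} {φβ u} {φβ v} (φβ≈φα u) (subst (AgreeOff φα (φβ v)) (sym mu≡mv) (φβ≈φα v))

  moved-injective : Injective _≡_ _≡_ moved
  moved-injective {u} {v} mu≡mv with u ≟ v
  ... | yes u≡v = u≡v
  ... | no  u≢v with agreeOff⇒≡⊎differ {x = φβ u} {φβ v} (φβ≈φβ mu≡mv)
  ...   | inj₁ φβu≡φβv = β-injective (to-injective (colouring-≡ B φβu≡φβv))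
  ...   | inj₂ φβu~φβv = contradiction (reflect (β u) (β v) φβu~φβv) (β-≁ u≢v)

  common-neighbour-of-β : ∀ {u v γ} → adj A u v ≡ true → γ ~ᴬ β u → γ ~ᴬ β v → γ ≡ α̂
  common-neighbour-of-β {u} {v} {γ} uv∈E γ~βu γ~βv
    with common-neighbour-of-updates (adj⇒≢ A uv∈E) (unused u) (unused v) γ~βu γ~βv
  ... | inj₁ γ≡α = colouring-≡ A γ≡α
  ... | inj₂ (γu≡c , γv≡c) = ⊥-elim (colouring-proper A γ u v uv∈E (trans γu≡c (sym γv≡c)))

  second-common-neighbour : ∀ {u v} → u ≢ v → adj B (moved u) (moved v) ≡ false →
    Σ (Colouring B kB) λ δ → δ ≢ to α̂ × δ ~ᴮ to (β u) × δ ~ᴮ to (β v)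
  second-common-neighbour {u} {v} u≢v mumv∉E =
    (δ , [ δ-proper ]) , δ≢φα , (moved v , δ≢φβu , δ≈φβu) , (moved u , δ≢φβv , δ≈φβv)
    where
    mu≢mv : moved u ≢ moved v
    mu≢mv = u≢v ∘ moved-injective

    δ : Map B kB
    δ = φβ v [ moved u ]≔ lookup (φβ u) (moved u)

    δ≈φβv : AgreeOff δ (φβ v) (moved u)
    δ≈φβv = []≔-agreeOff (φβ v) (moved u) _

    δ≈φβu : AgreeOff δ (φβ u) (moved v)
    δ≈φβu x x≢mv with x ≟ moved u
    ... | yes refl = lookup∘update x (φβ v) _
    ... | no  x≢mu = trans (δ≈φβv x x≢mu) (trans (sym (φβ≈φα v x x≢mv)) (φβ≈φα u x x≢mu))

    δ-proper : IsProper B δ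
    δ-proper = patch-proper B {δ} {φβ v} {φβ u}
                 (colouring-proper B (to (β v))) (colouring-proper B (to (β u))) δ≈φβv δ≈φβu mu≢mv mumv∉E

    δ≢φβv : lookup δ (moved u) ≢ lookup (φβ v) (moved u)
    δ≢φβv eq = moved-differs u (trans (trans (φβ≈φα v _ mu≢mv) (sym eq)) (δ≈φβu _ mu≢mv))

    δ≢φβu : lookup δ (moved v) ≢ lookup (φβ u) (moved v)
    δ≢φβu eq = moved-differs v (trans (trans (φβ≈φα u _ (mu≢mv ∘ sym)) (sym eq)) (δ≈φβv _ (mu≢mv ∘ sym)))

    δ≢φα : (δ , [ δ-proper ]) ≢ to α̂
    δ≢φα eq = moved-differs u (trans (cong (λ γ → lookup (proj₁ γ) (moved u)) (sym eq)) (δ≈φβu _ mu≢mv))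

  moved-preserves : Preserves (adj A) (adj B) moved
  moved-preserves u v uv∈E with adj B (moved u) (moved v) in mumv
  ... | true  = refl
  ... | false with δ , δ≢φα , δ~φβu , δ~φβv ← second-common-neighbour (adj⇒≢ A uv∈E) mumv =
    contradiction (begin
      δ              ≡⟨ strictlyInverseˡ δ ⟨
      to (from δ)    ≡⟨ cong to (common-neighbour-of-β uv∈E (reflect-from δ~φβu) (reflect-from δ~φβv)) ⟩
      to α̂           ∎) δ≢φα
    where open ≡-Reasoning

  monomorphism : Monomorphism (adj A) (adj B)
  monomorphism = record { to = moved ; injective = moved-injective ; preserves = moved-preserves }

recolouringIso⇒monomorphism : (A : Graph) (k : ℕ) → ChiBelow A k → (B : Graph) (k' : ℕ) →
                              AbsIso (Recolouring A k) (Recolouring B k') → Monomorphism (adj A) (adj B)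
recolouringIso⇒monomorphism A k (_ , (colourable , _) , m<k) =
  SpareColourEmbedding.monomorphism (colourable⇒spareColouring A colourable m<k)

theorem1p2 : (G : Graph) (k : ℕ) → ChiBelow G k →
    (H : Graph) (k' : ℕ) → ChiBelow H k' →
    AbsIso (Recolouring H k') (Recolouring G k) → H ≅ G
theorem1p2 G k χG<k H k' χH<k' φ =
  monomorphisms⇒isomorphic (recolouringIso⇒monomorphism H k' χH<k' G k φ)
                           (recolouringIso⇒monomorphism G k χG<k H k' (AbsIso-sym φ))
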